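{- Let a hash-based, order-invariant distinct counting sketching algorithm be given whose sketch size is bounded by $b$ bits, and suppose $n>\sup_r K_r$ (for input data sets of cardinality $n$). Then $\sup_r K_r\le b$.
   Context: Let $U$ be a universe of items. A randomized distinct counting sketching algorithm has internal randomness $r$, which specifies a uniformly random hash function $h$ on $U$; run on a data set (stream) $\mathcal D$ it produces a sketch state $S_r(\mathcal D)$. The algorithm is hash-based and order-invariant if $S_r(\mathcal D)$ depends only on the set of hash values $\{h(x):x\in\mathcal D\}$ (hence is invariant to order and duplication of items). For $i\in\mathcal D$, $\mathcal D_{ -i}=\mathcal D\setminus\{i\}$; $\mathcal K_r=\{i\in\mathcal D: S_r(\mathcal D_{ -i})\neq S_r(\mathcal D)\}$ and $K_r=|\mathcal K_r|$. -}

module Defs where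

open import Data.Nat using (ℕ)
open import Data.Bool using (Bool)
open import Data.Vec using (Vec)
open import Data.Vec.Properties using (≡-dec)
open import Data.List using (List; foldl; map; filter; length)
open import Data.List.Membership.Propositional using (_∈_)
open import Function.Bundles using (_⇔_)
open import Relation.Binary.PropositionalEquality using (_≡_)
open import Relation.Binary.Definitions using (DecidableEquality)
open import Relation.Nullary.Decidable using (¬?)
import Data.Bool as B

record SketchAlg (U H R : Set) (b : ℕ) : Set where
  field
    hash   : R → U → H
    init   : R → Vec Bool b
    update : R → Vec Bool b → U → Vec Bool b

  run : R → List U → Vec Bool b
  run r xs = foldl (update r) (init r) xs

open SketchAlg public

HashBasedOrderInvariant : {U H R : Set} {b : ℕ} → SketchAlg U H R b → Set
HashBasedOrderInvariant {U} {H} {R} A =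
  (r : R) (xs ys : List U) →
  ((v : H) → (v ∈ map (hash A r) xs) ⇔ (v ∈ map (hash A r) ys)) →
  run A r xs ≡ run A r ys

_≟S_ : {b : ℕ} → DecidableEquality (Vec Bool b)
_≟S_ = ≡-dec B._≟_

remove : {U : Set} → DecidableEquality U → U → List U → List U
remove _≟_ i D = filter (λ x → ¬? (x ≟ i)) D

Kset : {U H R : Set} {b : ℕ} → SketchAlg U H R b → DecidableEquality U →
       R → List U → List U
Kset A _≟_ r D = filter (λ i → ¬? (run A r (remove _≟_ i D) ≟S run A r D)) D

K : {U H R : Set} {b : ℕ} → SketchAlg U H R b → DecidableEquality U →
    R → List U → ℕ
K A _≟_ r D = length (Kset A _≟_ r D)

{-# OPTIONS --safe #-}
-- A subset C of 𝒦_r is recorded by the sketch of D ∖ C: if C and C′ differ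
-- in some i ∈ C ∖ C′ but S_r(D ∖ C) = S_r(D ∖ C′), then appending D_{-i} to
-- both streams preserves the equality and, the sketch depending only on the
-- set of items, turns the two sides into S_r(D_{-i}) and S_r(D), contradicting
-- i ∈ 𝒦_r. So the 2^{K_r} subsets of 𝒦_r inject into the 2^b sketch states.
module Submission where

open import Defs
open import Data.Bool using (Bool; true; false)
open import Data.Bool.Properties using (¬-not; ⇔→≡) renaming (_≟_ to _≟ᵇ_)
open import Data.Empty using (⊥-elim)
open import Data.Fin using (Fin; combine; remQuot) renaming (zero to fzero; suc to fsuc)
open import Data.Fin.Properties using (remQuot-combine; combine-remQuot; injective⇒≤; 2↔Bool)
open import Data.List using (List; []; _∷_; _++_; length; lookup; filter; foldl)
open import Data.List.Properties using (foldl-++)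
open import Data.List.Membership.Propositional using (_∈_; _∉_)
open import Data.List.Membership.Propositional.Properties
  using (∈-++⁻; ∈-++⁺ˡ; ∈-++⁺ʳ; ∈-filter⁺; ∈-filter⁻; ∈-lookup)
import Data.List.Membership.DecPropositional as DecMembership
open import Data.List.Relation.Binary.BagAndSetEquality using (_∼[_]_; set; map-cong)
open import Data.List.Relation.Binary.Subset.Propositional using (_⊆_)
open import Data.List.Relation.Binary.Subset.Propositional.Properties using (filter-⊆)
open import Data.List.Relation.Unary.Any using (here; there)
open import Data.List.Relation.Unary.AllPairs using (_∷_)
open import Data.List.Relation.Unary.Unique.Propositional using (Unique)
open import Data.List.Relation.Unary.Unique.Propositional.Properties using (filter⁺; Unique[x∷xs]⇒x∉xs)
open import Data.Nat using (ℕ; zero; suc; _^_; _<_; _≤_)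
open import Data.Nat.Properties using (^-monoʳ-<; ≮⇒≥; <⇒≱; n<1+n)
open import Data.Product using (_×_; _,_; uncurry)
open import Data.Sum using ([_,_])
open import Data.Vec using (Vec; []; _∷_; tabulate) renaming (lookup to lookupᵥ)
open import Data.Vec.Properties using (tabulate∘lookup; tabulate-cong)
open import Function using (_∘_; _↔_; _↣_; mk⇔; mk↔ₛ′; mk↣; Inverse; Injection; Injective)
open import Function.Properties.Inverse using (↔-sym; ↔⇒↣)
open import Function.Properties.Injection using (↣-trans)
open import Relation.Binary.Definitions using (DecidableEquality)
open import Relation.Binary.PropositionalEquality
  using (_≡_; _≢_; refl; sym; trans; cong; cong₂; subst; module ≡-Reasoning)
open import Relation.Nullary using (yes; no; ¬?)

module _ {A : Set} {m : ℕ} (A↔Fin : A ↔ Fin m) where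
  open Inverse A↔Fin

  private
    encode : ∀ {k} → Vec A k → Fin (m ^ k)
    encode []       = fzero
    encode (x ∷ xs) = combine (to x) (encode xs)

    decode : ∀ k → Fin (m ^ k) → Vec A k
    decode′ : ∀ k → Fin m × Fin (m ^ k) → Vec A (suc k)
    decode zero    _ = []
    decode (suc k) i = decode′ k (remQuot (m ^ k) i)
    decode′ k (i , j) = from i ∷ decode k j

    encode-decode : ∀ k (i : Fin (m ^ k)) → encode (decode k i) ≡ i
    encode-decode′ : ∀ k (p : Fin m × Fin (m ^ k)) → encode (decode′ k p) ≡ uncurry combine p
    encode-decode zero    fzero = refl
    encode-decode (suc k) i = trans (encode-decode′ k (remQuot (m ^ k) i)) (combine-remQuot {m} (m ^ k) i)
    encode-decode′ k (i , j) = cong₂ combine (strictlyInverseˡ i) (encode-decode k j)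

    decode-encode : ∀ {k} (xs : Vec A k) → decode k (encode xs) ≡ xs
    decode-encode []       = refl
    decode-encode (x ∷ xs) = trans (cong (decode′ _) (remQuot-combine (to x) (encode xs)))
                                   (cong₂ _∷_ (strictlyInverseʳ x) (decode-encode xs))

  Vec↔Fin^ : ∀ k → Vec A k ↔ Fin (m ^ k)
  Vec↔Fin^ k = mk↔ₛ′ encode (decode k) (encode-decode k) decode-encode

  Vec↣Vec⇒≤ : 1 < m → ∀ {k b} → Vec A k ↣ Vec A b → k ≤ b
  Vec↣Vec⇒≤ 1<m {k} {b} f = ≮⇒≥ λ b<k → <⇒≱ (^-monoʳ-< m 1<m b<k) m^k≤m^b
    where
    m^k≤m^b : m ^ k ≤ m ^ b
    m^k≤m^b = injective⇒≤ (Injection.injective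
      (↣-trans (↔⇒↣ (↔-sym (Vec↔Fin^ k))) (↣-trans f (↔⇒↣ (Vec↔Fin^ b)))))

module _ {A : Set} where

  select : (xs : List A) → Vec Bool (length xs) → List A
  select []       []          = []
  select (x ∷ xs) (true ∷ v)  = x ∷ select xs v
  select (x ∷ xs) (false ∷ v) = select xs v

  select-⊆ : ∀ xs v → select xs v ⊆ xs
  select-⊆ []       []          ()
  select-⊆ (x ∷ xs) (true ∷ v)  (here x≡y)   = here x≡y
  select-⊆ (x ∷ xs) (true ∷ v)  (there y∈)   = there (select-⊆ xs v y∈)
  select-⊆ (x ∷ xs) (false ∷ v) y∈           = there (select-⊆ xs v y∈)

  ∈-select : ∀ xs v j → lookupᵥ v j ≡ true → lookup xs j ∈ select xs v
  ∈-select (x ∷ xs) (true ∷ v)  fzero    refl = here refl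
  ∈-select (x ∷ xs) (true ∷ v)  (fsuc j) vⱼ   = there (∈-select xs v j vⱼ)
  ∈-select (x ∷ xs) (false ∷ v) (fsuc j) vⱼ   = ∈-select xs v j vⱼ

  ∉-select : ∀ {xs} → Unique xs → ∀ v j → lookupᵥ v j ≡ false → lookup xs j ∉ select xs v
  ∉-select {x ∷ xs} (x∉ ∷ u) (false ∷ v) fzero    refl x∈ =
    Unique[x∷xs]⇒x∉xs (x∉ ∷ u) (select-⊆ xs v x∈)
  ∉-select {x ∷ xs} (x∉ ∷ u) (true ∷ v)  (fsuc j) vⱼ (here x≡) =
    Unique[x∷xs]⇒x∉xs (x∉ ∷ u) (subst (_∈ xs) x≡ (∈-lookup j))
  ∉-select {x ∷ xs} (_ ∷ u) (true ∷ v)  (fsuc j) vⱼ (there x∈) = ∉-select u v j vⱼ x∈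
  ∉-select {x ∷ xs} (_ ∷ u) (false ∷ v) (fsuc j) vⱼ x∈         = ∉-select u v j vⱼ x∈

module _ {U H R : Set} (_≟_ : DecidableEquality U) {b : ℕ}
         (A : SketchAlg U H R b) (order-invariant : HashBasedOrderInvariant A) (r : R) where

  open DecMembership _≟_ using (_∈?_)

  infixl 6 _∖_
  _∖_ : List U → List U → List U
  D ∖ C = filter (λ x → ¬? (x ∈? C)) D

  run-resp-∼set : ∀ {xs ys} → xs ∼[ set ] ys → run A r xs ≡ run A r ys
  run-resp-∼set xs∼ys = order-invariant r _ _ λ _ → map-cong (λ _ → refl) xs∼ys

  run-++-congˡ : ∀ {xs ys} zs → run A r xs ≡ run A r ys → run A r (xs ++ zs) ≡ run A r (ys ++ zs)
  run-++-congˡ {xs} {ys} zs eq = begin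
    run A r (xs ++ zs)                          ≡⟨ foldl-++ (update A r) (init A r) xs zs ⟩
    foldl (update A r) (run A r xs) zs          ≡⟨ cong (λ s → foldl (update A r) s zs) eq ⟩
    foldl (update A r) (run A r ys) zs          ≡⟨ foldl-++ (update A r) (init A r) ys zs ⟨
    run A r (ys ++ zs)                          ∎
    where open ≡-Reasoning

  ∖-++-remove∼remove : ∀ {i C} D → i ∈ C → D ∖ C ++ remove _≟_ i D ∼[ set ] remove _≟_ i D
  ∖-++-remove∼remove {i} {C} D i∈C =
    mk⇔ ([ ∖⊆remove , (λ y∈ → y∈) ] ∘ ∈-++⁻ (D ∖ C)) (∈-++⁺ʳ (D ∖ C))
    where
    ∖⊆remove : D ∖ C ⊆ remove _≟_ i D
    ∖⊆remove y∈ with ∈-filter⁻ (λ x → ¬? (x ∈? C)) {xs = D} y∈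
    ... | y∈D , y∉C = ∈-filter⁺ (λ x → ¬? (x ≟ i)) y∈D λ { refl → y∉C i∈C }

  ∖-++-remove∼id : ∀ {i C} D → i ∈ D → i ∉ C → D ∖ C ++ remove _≟_ i D ∼[ set ] D
  ∖-++-remove∼id {i} {C} D i∈D i∉C =
    mk⇔ ([ filter-⊆ _ D , filter-⊆ _ D ] ∘ ∈-++⁻ (D ∖ C)) restore
    where
    restore : D ⊆ D ∖ C ++ remove _≟_ i D
    restore {y} y∈D with y ≟ i
    ... | yes refl = ∈-++⁺ˡ (∈-filter⁺ (λ x → ¬? (x ∈? C)) y∈D i∉C)
    ... | no  y≢i  = ∈-++⁺ʳ (D ∖ C) (∈-filter⁺ (λ x → ¬? (x ≟ i)) y∈D y≢i)

  run-∖-separates : ∀ {i C C′ D} → i ∈ Kset A _≟_ r D → i ∈ C → i ∉ C′ →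
                    run A r (D ∖ C) ≢ run A r (D ∖ C′)
  run-∖-separates {i} {C} {C′} {D} i∈K i∈C i∉C′ eq with ∈-filter⁻ _ {xs = D} i∈K
  ... | i∈D , removal-changes = removal-changes (begin
    run A r (remove _≟_ i D)                    ≡⟨ run-resp-∼set (∖-++-remove∼remove D i∈C) ⟨
    run A r (D ∖ C ++ remove _≟_ i D)           ≡⟨ run-++-congˡ {D ∖ C} {D ∖ C′} (remove _≟_ i D) eq ⟩
    run A r (D ∖ C′ ++ remove _≟_ i D)          ≡⟨ run-resp-∼set (∖-++-remove∼id D i∈D i∉C′) ⟩
    run A r D                                   ∎)
    where open ≡-Reasoning

  module _ {D : List U} (unique-D : Unique D) where

    run-∖-select-injective : Injective _≡_ _≡_ (λ v → run A r (D ∖ select (Kset A _≟_ r D) v))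
    run-∖-select-injective {v} {w} eq = begin
      v                   ≡⟨ tabulate∘lookup v ⟨
      tabulate (lookupᵥ v) ≡⟨ tabulate-cong (λ j → ⇔→≡ (mk⇔ (kept eq j) (kept (sym eq) j))) ⟩
      tabulate (lookupᵥ w) ≡⟨ tabulate∘lookup w ⟩
      w                   ∎
      where
      open ≡-Reasoning
      ks : List U
      ks = Kset A _≟_ r D
      kept : ∀ {v w} → run A r (D ∖ select ks v) ≡ run A r (D ∖ select ks w) →
             ∀ j → lookupᵥ v j ≡ true → lookupᵥ w j ≡ true
      kept {v} {w} eq j vⱼ with lookupᵥ w j ≟ᵇ true
      ... | yes wⱼ = wⱼ
      ... | no  wⱼ = ⊥-elim (run-∖-separates {D = D} (∈-lookup j) (∈-select ks v j vⱼ)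
                               (∉-select (filter⁺ _ unique-D) w j (¬-not wⱼ)) eq)

    K≤b : K A _≟_ r D ≤ b
    K≤b = Vec↣Vec⇒≤ (↔-sym 2↔Bool) (n<1+n 1) (mk↣ run-∖-select-injective)

lemma3 : {U H R : Set} (_≟_ : DecidableEquality U) (b n : ℕ)
    (A : SketchAlg U H R b) → HashBasedOrderInvariant A →
    (D : List U) → Unique D → length D ≡ n →
    ((r : R) → K A _≟_ r D < n) →
    (r : R) → K A _≟_ r D ≤ b
lemma3 _≟_ b n A order-invariant D unique-D _ _ r = K≤b _≟_ A order-invariant r unique-D
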